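{- For all integers $l > d > 0$, $A(l,d) = A(l-1,d-1) + A(l-1,d) + 1$.
   Context: A rooted binary tree is a rooted tree in which every vertex has at most two children; the empty tree (0 vertices) is allowed. $B_m$ is the complete binary tree with $m$ layers, and a subdivision of $B_m$ is obtained by replacing some edges by paths; it is rooted at the root of $B_m$. A subdivision $S$ of $B_m$ is contained in a rooted tree $T$ as a compatible subgraph if $S$ is (isomorphic to) a subtree of $T$ such that the root of $S$ is the vertex of this subtree closest to the root of $T$. For integers $l,d\ge 0$, $A(l,d)$ is the maximum number $n$ such that there exists a rooted binary tree on $n$ vertices with at most $l$ layers that does not contain a subdivision of $B_{d+1}$ as a compatible subgraph. -}

module Defs where

open import Data.Nat using (ℕ; zero; suc; _+_; _⊔_; _≤_)
open import Data.Product using (Σ; _×_)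
open import Relation.Binary.PropositionalEquality using (_≡_)
open import Relation.Nullary using (¬_)

-- Rooted binary trees (empty tree allowed). A vertex has at most two
-- children; we record them as a (left,right) pair of possibly empty subtrees.
data BTree : Set where
  empty : BTree
  node  : BTree → BTree → BTree

size : BTree → ℕ
size empty      = 0
size (node l r) = suc (size l + size r)

layers : BTree → ℕ
layers empty      = 0
layers (node l r) = suc (layers l ⊔ layers r)

-- HasSubdivB m t : t contains a subdivision of the complete binary tree B_m
-- (m layers) as a compatible subgraph, i.e. the root of the subdivision is
-- its vertex closest to the root of t.
--  * B_0 is the empty tree, contained in every tree.
--  * B_(m+1) is a root whose (for m ≥ 1) two children are roots of copies of B_m.
--    A compatible subdivided copy is rooted at some vertex v of t; its two
--    (subdivided) edges leave v downwards through the two distinct children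
--    of v, so each child subtree of v contains a compatible subdivision of B_m.
data HasSubdivB : ℕ → BTree → Set where
  base  : ∀ {t} → HasSubdivB 0 t
  root  : ∀ {m l r} → HasSubdivB m l → HasSubdivB m r → HasSubdivB (suc m) (node l r)
  left  : ∀ {m l r} → HasSubdivB (suc m) l → HasSubdivB (suc m) (node l r)
  right : ∀ {m l r} → HasSubdivB (suc m) r → HasSubdivB (suc m) (node l r)

Admissible : ℕ → ℕ → BTree → Set
Admissible l d t = (layers t ≤ l) × ¬ HasSubdivB (suc d) t

-- IsA l d n : n = A(l,d), i.e. n is the maximum size of an admissible tree.
IsA : ℕ → ℕ → ℕ → Set
IsA l d n =
  (Σ BTree λ t → Admissible l d t × size t ≡ n) ×
  (∀ t → Admissible l d t → size t ≤ n)

module Submission where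

-- We define the right-hand side directly: A 0 d = 0, A (l+1) 0 = 0 and
-- A (l+1) (d+1) = A l d + A l (d+1) + 1, and show that this number is the
-- true maximum for every l and d (IsA l d (A l d)); the theorem then only
-- reorders the summands.
--  * Lower bound: the extremal tree of shape (l+1,d+1) is a root whose
--    left subtree is the extremal tree of shape (l,d) and whose right
--    subtree is that of shape (l,d+1); it has A l d vertices, at most l
--    layers and no compatible subdivision of B (d+1).
--  * Upper bound: if node L R is admissible for (l+1,d+1), then both
--    children have at most l layers and avoid B (d+2), and at least one of
--    them even avoids B (d+1) (otherwise the root carries a copy of
--    B (d+2)). Induction on l bounds the size by A l d + A l (d+1) + 1.

open import Defs
open import Data.Nat using (ℕ; zero; suc; _+_; _∸_; _<_; _≤_; z≤n; s≤s; _⊔_)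
open import Data.Nat.Properties using (+-comm; +-mono-≤; m⊔n≤o⇒m≤o; m⊔n≤o⇒n≤o; ⊔-lub)
open import Data.Product using (Σ; _×_; _,_)
open import Data.Sum using (_⊎_; inj₁; inj₂)
open import Relation.Binary.PropositionalEquality using (_≡_; refl; subst; cong₂)
open import Relation.Nullary using (¬_; Dec; yes; no)

A : ℕ → ℕ → ℕ
A zero    d       = 0
A (suc l) zero    = 0
A (suc l) (suc d) = suc (A l d + A l (suc d))

-- A compatible subdivision of B (m+1) contains one of B m (drop the last
-- layer); used to see that avoiding B (d+1) implies avoiding B (d+2).
HasSubdivB-pred : ∀ {m t} → HasSubdivB (suc m) t → HasSubdivB m t
HasSubdivB-pred {zero}  _          = base
HasSubdivB-pred {suc m} (root a b) = root (HasSubdivB-pred a) (HasSubdivB-pred b)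
HasSubdivB-pred {suc m} (left h)   = left (HasSubdivB-pred h)
HasSubdivB-pred {suc m} (right h)  = right (HasSubdivB-pred h)

-- Containing a compatible subdivision of B m is decidable; the upper bound
-- needs to know which child of the root avoids B (d+1).
hasSubdivB? : ∀ m t → Dec (HasSubdivB m t)
hasSubdivB? zero    t          = yes base
hasSubdivB? (suc m) empty      = no λ ()
hasSubdivB? (suc m) (node l r)
  with hasSubdivB? m l | hasSubdivB? m r | hasSubdivB? (suc m) l | hasSubdivB? (suc m) r
... | yes a | yes b | _     | _     = yes (root a b)
... | _     | _     | yes c | _     = yes (left c)
... | _     | _     | _     | yes c = yes (right c)
... | no a  | _     | no c  | no e  = no λ { (root x _) → a x ; (left x) → c x ; (right x) → e x }
... | _     | no b  | no c  | no e  = no λ { (root _ y) → b y ; (left x) → c x ; (right x) → e x }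

extremal : ℕ → ℕ → BTree
extremal zero    d       = empty
extremal (suc l) zero    = empty
extremal (suc l) (suc d) = node (extremal l d) (extremal l (suc d))

extremal-size : ∀ l d → size (extremal l d) ≡ A l d
extremal-size zero    d       = refl
extremal-size (suc l) zero    = refl
extremal-size (suc l) (suc d) =
  cong₂ (λ x y → suc (x + y)) (extremal-size l d) (extremal-size l (suc d))

extremal-layers : ∀ l d → layers (extremal l d) ≤ l
extremal-layers zero    d       = z≤n
extremal-layers (suc l) zero    = z≤n
extremal-layers (suc l) (suc d) =
  s≤s (⊔-lub (extremal-layers l d) (extremal-layers l (suc d)))

-- A copy of B (d+2) in the extremal tree would need a copy of B (d+1) in its
-- left subtree, either directly (root) or after dropping a layer (left).
extremal-avoids : ∀ l d → ¬ HasSubdivB (suc d) (extremal l d)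
extremal-avoids zero    d       ()
extremal-avoids (suc l) zero    ()
extremal-avoids (suc l) (suc d) (root h _) = extremal-avoids l d h
extremal-avoids (suc l) (suc d) (left h)   = extremal-avoids l d (HasSubdivB-pred h)
extremal-avoids (suc l) (suc d) (right h)  = extremal-avoids l (suc d) h

extremal-admissible : ∀ l d → Admissible l d (extremal l d)
extremal-admissible l d = extremal-layers l d , extremal-avoids l d

children-layers : ∀ {l L R} → layers (node L R) ≤ suc l → layers L ≤ l × layers R ≤ l
children-layers {L = L} {R} (s≤s lay) =
  m⊔n≤o⇒m≤o (layers L) (layers R) lay , m⊔n≤o⇒n≤o (layers L) (layers R) lay

-- The children of an admissible node: one is admissible for (l,d), the other
-- for (l,d+1). Both avoid B (d+2), and they cannot both contain B (d+1).
children-admissible : ∀ {l d L R} → Admissible (suc l) (suc d) (node L R) →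
  (Admissible l d L × Admissible l (suc d) R) ⊎ (Admissible l (suc d) L × Admissible l d R)
children-admissible {d = d} {L} (lay , avoids) with children-layers lay | hasSubdivB? (suc d) L
... | layersL , layersR | no noL =
  inj₁ ((layersL , noL) , (layersR , λ h → avoids (right h)))
... | layersL , layersR | yes hasL =
  inj₂ ((layersL , λ h → avoids (left h)) , (layersR , λ h → avoids (root hasL h)))

admissible-size≤ : ∀ l d t → Admissible l d t → size t ≤ A l d
admissible-size≤ l       d       empty      _             = z≤n
admissible-size≤ zero    d       (node L R) (() , _)
admissible-size≤ (suc l) zero    (node L R) (_ , avoids)  with avoids (root base base)
... | ()
admissible-size≤ (suc l) (suc d) (node L R) adm with children-admissible adm
... | inj₁ (admL , admR) =
  s≤s (+-mono-≤ (admissible-size≤ l d L admL) (admissible-size≤ l (suc d) R admR))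
... | inj₂ (admL , admR) =
  s≤s (subst (_≤ A l d + A l (suc d)) (+-comm (size R) (size L))
        (+-mono-≤ (admissible-size≤ l d R admR) (admissible-size≤ l (suc d) L admL)))

A-isA : ∀ l d → IsA l d (A l d)
A-isA l d =
  (extremal l d , extremal-admissible l d , extremal-size l d) ,
  λ t adm → admissible-size≤ l d t adm

lemma15 : ∀ (l d : ℕ) → 0 < d → d < l →
    Σ ℕ λ a → Σ ℕ λ b →
    IsA (l ∸ 1) (d ∸ 1) a × IsA (l ∸ 1) d b × IsA l d (a + b + 1)
lemma15 zero    (suc d) _ ()
lemma15 (suc l) (suc d) _ _ =
  A l d , A l (suc d) , A-isA l d , A-isA l (suc d) ,
  subst (IsA (suc l) (suc d)) (+-comm 1 (A l d + A l (suc d))) (A-isA (suc l) (suc d))
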